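{- Let $\alpha\in(0,1)\setminus\mathbb{Q}$ have continued fraction partial quotients $(a_k)_{k\ge1}$ and convergent denominators $(q_k)_{k\ge -1}$, and put $q_k^*:=(-1)^kq_k$. For every integer $Z$ there exist $\ell\ge 0$ and a $(-\alpha)$-admissible finite digit sequence $(b_k)_{k=1}^{\ell}$ such that \[Z=\sum_{k=1}^{\ell} b_k\, q^*_{k-1},\] and this digit sequence is unique, where digit sequences differing only by trailing zeros are identified (equivalently, it is unique if one requires $b_\ell\neq0$ when $\ell\ge1$). For $Z=0$ the expansion is the empty one ($\ell=0$).
   Context: Write $\alpha=\cfrac{1}{a_1+\cfrac{1}{a_2+\cfrac{1}{a_3+\cdots}}}$ with positive integers $a_k$ (the partial quotients). The denominators of the convergents satisfy $q_{ -1}:=0$, $q_0:=1$, $q_k=a_kq_{k-1}+q_{k-2}$ for $k\ge1$, and $q_k^*:=(-1)^kq_k$ for $k\ge -1$. A digit sequence $(b_k)_{k=1}^{\ell}$ of nonnegative integers is called $(-\alpha)$-admissible if: (i) $b_k\le a_k$ for all $k\ge1$; (ii) for every $k\ge1$, if $b_k=a_k$ then $b_{k+1}=0$ (with $b_{k}:=0$ for $k>\ell$). -}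

module Defs where

open import Data.Nat using (ℕ; zero; suc; _+_; _*_; _≤_)
open import Data.Integer as ℤ using (ℤ; +_; -_)
open import Data.List using (List; []; _∷_; last)
open import Data.Maybe using (just)
open import Data.Product using (_×_)
open import Relation.Binary.PropositionalEquality using (_≡_; _≢_)

-- Partial quotients are given as a : ℕ → ℕ, where a k is a_k for k ≥ 1
-- (the value a 0 is never used).

-- q a k = q_k for k ≥ 0, with q_{-1} = 0, q_0 = 1, q_k = a_k q_{k-1} + q_{k-2}.
q : (ℕ → ℕ) → ℕ → ℕ
q a zero = 1
q a (suc zero) = a 1 * 1 + 0
q a (suc (suc k)) = a (suc (suc k)) * q a (suc k) + q a k

signAlt : ℕ → ℤ → ℤ
signAlt zero z = z
signAlt (suc n) z = - signAlt n z

qStar : (ℕ → ℕ) → ℕ → ℤ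
qStar a k = signAlt k (+ q a k)

-- digit bs k = b_k for 1 ≤ k ≤ ℓ (bs = [b_1, …, b_ℓ]), and 0 for k > ℓ (and k = 0).
digit : List ℕ → ℕ → ℕ
digit [] _ = 0
digit (b ∷ bs) zero = 0
digit (b ∷ bs) (suc zero) = b
digit (b ∷ bs) (suc (suc k)) = digit bs (suc k)

Admissible : (ℕ → ℕ) → List ℕ → Set
Admissible a bs = ∀ k → 1 ≤ k →
  (digit bs k ≤ a k) × (digit bs k ≡ a k → digit bs (suc k) ≡ 0)

-- valueFrom a i [b_{i+1}, …] = Σ_j b_j q*_{j-1}, starting at index j = i+1.
valueFrom : (ℕ → ℕ) → ℕ → List ℕ → ℤ
valueFrom a i [] = + 0
valueFrom a i (b ∷ bs) = (+ b) ℤ.* qStar a i ℤ.+ valueFrom a (suc i) bs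

value : (ℕ → ℕ) → List ℕ → ℤ
value a bs = valueFrom a 0 bs

NoTrailingZero : List ℕ → Set
NoTrailingZero bs = last bs ≢ just 0

-- The admissible strings b_1 … b_n of length n are ranked bijectively onto
-- [0, q_n + q_{n-1}), those with b_n = a_n occupying exactly the ranks ≥ q_n: adding
-- a top digit j reflects the rank inside [0, (j+1) q_n + q_{n-1}), which carries the
-- strings that admit j onto the j-th block of the partition
--   [0, q_n + q_{n-1}) ∪ ⋃_{1 ≤ j ≤ a_{n+1}} [j q_n + q_{n-1}, (j+1) q_n + q_{n-1})
-- of [0, q_{n+1} + q_n).  The rank is (-1)^n times the value up to an additive
-- constant, so strings of a fixed length have distinct values, filling an interval
-- that exhausts ℤ as n grows; padding with zeros compares strings of different lengths.

module Submission where

open import Defs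
open import Algebra.Properties.AbelianGroup using (∙-cancelˡ; ∙-cancelʳ)
open import Data.Integer.Base as ℤ using (ℤ; +_; -_; -[1+_]; ∣_∣)
import Data.Integer.Properties as ℤ
open import Data.Integer.Tactic.RingSolver using (solve-∀)
open import Data.List using (List; []; _∷_; _++_; [_]; _∷ʳ_; length; reverse; replicate; head; last)
open import Data.List.Properties
  using (length-++; length-replicate; length-reverse; reverse-involutive; reverse-injective; unfold-reverse)
open import Data.Maybe using (just)
open import Data.Maybe.Properties using (just-injective)
open import Data.Nat using (ℕ; zero; suc; _+_; _*_; _∸_; _≤_; _<_; z≤n; s≤s; z<s; NonZero; >-nonZero)
open import Data.Nat.Properties
open import Data.Product using (Σ; _×_; _,_; proj₁; proj₂)
open import Data.Sum using (_⊎_; inj₁; inj₂)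
open import Data.Unit using (⊤; tt)
open import Relation.Binary.Definitions using (tri<; tri≈; tri>)
open import Relation.Binary.PropositionalEquality
  using (_≡_; _≢_; refl; sym; trans; cong; cong₂; subst; module ≡-Reasoning)
open import Function using (_∘_)
open import Relation.Nullary using (¬_; yes; no; contradiction)

reflect : ℕ → ℕ → ℕ
reflect m x = m ∸ suc x

reflect-< : ∀ {m x} → x < m → reflect m x < m
reflect-< x<m = ∸-monoʳ-< z<s x<m

reflect-involutive : ∀ {m x} → x < m → reflect m (reflect m x) ≡ x
reflect-involutive {suc m} (s≤s x≤m) = m∸[m∸n]≡n x≤m

reflect-injective : ∀ {m x y} → x < m → y < m → reflect m x ≡ reflect m y → x ≡ y
reflect-injective {m} {x} {y} x<m y<m eq = begin
  x                        ≡⟨ reflect-involutive x<m ⟨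
  reflect m (reflect m x)  ≡⟨ cong (reflect m) eq ⟩
  reflect m (reflect m y)  ≡⟨ reflect-involutive y<m ⟩
  y                        ∎
  where open ≡-Reasoning

reflect-≥ : ∀ {k x} l → x < k → l ≤ reflect (k + l) x
reflect-≥ {k} {x} l x<k = subst (l ≤_) (sym (+-∸-comm l x<k)) (m≤n+m l (k ∸ suc x))

reflect-<ʳ : ∀ {k l x} .{{_ : NonZero k}} → l ≤ x → reflect (k + l) x < k
reflect-<ʳ {k} {l} {x} l≤x =
  m<n+o⇒m∸n<o (k + l) (suc x) (s≤s (subst (k + l ≤_) (+-comm k x) (+-monoʳ-≤ k l≤x)))

-- The blocks [0, Q + M) and [j Q + M, (j+1) Q + M), j ≥ 1, partition [0, (A+1) Q + M).

InBlock : ℕ → ℕ → ℕ → ℕ → Set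
InBlock Q M j c = c < Q + (j * Q + M) × (j ≡ 0 ⊎ j * Q + M ≤ c)

InBlock-≤ : ∀ {Q M j k c} → InBlock Q M j c → InBlock Q M k c → k ≤ j
InBlock-≤ _ (_ , inj₁ refl) = z≤n
InBlock-≤ {Q} {M} {j} {k} {c} (c<end , _) (_ , inj₂ start≤c) =
  ≤-pred (*-cancelʳ-< Q k (suc j) (+-cancelʳ-< M (k * Q) (suc j * Q) (begin-strict
    k * Q + M         ≤⟨ start≤c ⟩
    c                 <⟨ c<end ⟩
    Q + (j * Q + M)   ≡⟨ +-assoc Q (j * Q) M ⟨
    suc j * Q + M     ∎)))
  where open ≤-Reasoning

InBlock-unique : ∀ {Q M j k c} → InBlock Q M j c → InBlock Q M k c → j ≡ k
InBlock-unique j-block k-block = ≤-antisym (InBlock-≤ k-block j-block) (InBlock-≤ j-block k-block)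

InBlock-exists : ∀ {Q M c} A → c < Q + (A * Q + M) → Σ ℕ λ j → j ≤ A × InBlock Q M j c
InBlock-exists zero c<end = 0 , z≤n , c<end , inj₁ refl
InBlock-exists {Q} {M} {c} (suc A) c<end with c <? Q + (A * Q + M)
... | yes c<prev = let j , j≤A , j-block = InBlock-exists A c<prev in j , m≤n⇒m≤1+n j≤A , j-block
... | no c≮prev  = suc A , ≤-refl , c<end , inj₂ (subst (_≤ c) (sym (+-assoc Q (A * Q) M)) (≮⇒≥ c≮prev))

-- Ranks of the strings that admit j as next digit: non-full strings have rank < Q.

Extendable : ℕ → ℕ → ℕ → ℕ → Set
Extendable Q M j x = x < Q + M × (j ≡ 0 ⊎ x < Q)

Extendable⇒InBlock : ∀ {Q M j x} → Extendable Q M j x → InBlock Q M j (reflect (Q + (j * Q + M)) x)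
Extendable⇒InBlock {Q} {M} {j} (x< , ext) = reflect-< (<-≤-trans x< (+-monoʳ-≤ Q (m≤n+m M (j * Q)))) , start ext
  where
  start : ∀ {x} → j ≡ 0 ⊎ x < Q → j ≡ 0 ⊎ j * Q + M ≤ reflect (Q + (j * Q + M)) x
  start (inj₁ j≡0) = inj₁ j≡0
  start (inj₂ x<Q) = inj₂ (reflect-≥ (j * Q + M) x<Q)

InBlock⇒Extendable : ∀ {Q M j c} .{{_ : NonZero Q}} → InBlock Q M j c →
  Extendable Q M j (reflect (Q + (j * Q + M)) c)
InBlock⇒Extendable (c<end , inj₁ refl) = reflect-< c<end , inj₁ refl
InBlock⇒Extendable {Q} {M} (_ , inj₂ start≤c) = ≤-trans r<Q (m≤m+n Q M) , inj₂ r<Q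
  where r<Q = reflect-<ʳ start≤c

digit-0 : ∀ xs → digit xs 0 ≡ 0
digit-0 []      = refl
digit-0 (_ ∷ _) = refl

digit-++ˡ : ∀ xs ys {k} → k ≤ length xs → digit (xs ++ ys) k ≡ digit xs k
digit-++ˡ []       ys z≤n = digit-0 ys
digit-++ˡ (x ∷ xs) ys {zero}          _         = refl
digit-++ˡ (x ∷ xs) ys {suc zero}      _         = refl
digit-++ˡ (x ∷ xs) ys {suc (suc k)} (s≤s k<len) = digit-++ˡ xs ys k<len

digit-∷ʳ : ∀ xs j → digit (xs ∷ʳ j) (suc (length xs)) ≡ j
digit-∷ʳ []       j = refl
digit-∷ʳ (x ∷ xs) j = digit-∷ʳ xs j

digit-beyond : ∀ xs {k} → length xs < k → digit xs k ≡ 0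
digit-beyond []       _ = refl
digit-beyond (x ∷ xs) {suc zero}    (s≤s ())
digit-beyond (x ∷ xs) {suc (suc k)} (s≤s len<k) = digit-beyond xs len<k

length-∷ʳ : ∀ (xs : List ℕ) j → length (xs ∷ʳ j) ≡ suc (length xs)
length-∷ʳ xs j = trans (length-++ xs) (+-comm (length xs) 1)

last-digit : ∀ xs → 1 ≤ length xs → last xs ≡ just (digit xs (length xs))
last-digit (x ∷ [])     _ = refl
last-digit (x ∷ y ∷ ys) _ = last-digit (y ∷ ys) (s≤s z≤n)

last≡just : ∀ xs {v} → last xs ≡ just v → 1 ≤ length xs × digit xs (length xs) ≡ v
last≡just xs@(_ ∷ _) eq = s≤s z≤n , just-injective (trans (sym (last-digit xs (s≤s z≤n))) eq)

last-∷ʳ : ∀ (xs : List ℕ) x → last (xs ∷ʳ x) ≡ just x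
last-∷ʳ []           x = refl
last-∷ʳ (y ∷ [])     x = refl
last-∷ʳ (y ∷ z ∷ zs) x = last-∷ʳ (z ∷ zs) x

last-reverse : ∀ (xs : List ℕ) → last (reverse xs) ≡ head xs
last-reverse []       = refl
last-reverse (x ∷ xs) = trans (cong last (unfold-reverse x xs)) (last-∷ʳ (reverse xs) x)

module _ (a : ℕ → ℕ) (xs : List ℕ) (j : ℕ) where

  private
    L = length xs

    prefix : ∀ {k} → k ≤ L → digit (xs ∷ʳ j) k ≡ digit xs k
    prefix = digit-++ˡ xs [ j ]

  Admissible-∷ʳ⁻ : Admissible a (xs ∷ʳ j) →
    Admissible a xs × j ≤ a (suc L) × (last xs ≡ just (a L) → j ≡ 0)
  Admissible-∷ʳ⁻ adm = adm-xs , j≤a , top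
    where
    adm-xs : Admissible a xs
    adm-xs k 1≤k = bound , next
      where
      bound : digit xs k ≤ a k
      bound with k ≤? L
      ... | yes k≤L = subst (_≤ a k) (prefix k≤L) (proj₁ (adm k 1≤k))
      ... | no  k≰L = subst (_≤ a k) (sym (digit-beyond xs (≰⇒> k≰L))) z≤n
      next : digit xs k ≡ a k → digit xs (suc k) ≡ 0
      next with suc k ≤? L
      ... | yes k<L = λ full → trans (sym (prefix k<L)) (proj₂ (adm k 1≤k) (trans (prefix (<⇒≤ k<L)) full))
      ... | no  k≮L = λ _ → digit-beyond xs (≰⇒> k≮L)
    j≤a : j ≤ a (suc L)
    j≤a = subst (_≤ a (suc L)) (digit-∷ʳ xs j) (proj₁ (adm (suc L) (s≤s z≤n)))
    top : last xs ≡ just (a L) → j ≡ 0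
    top lst = let 1≤L , full = last≡just xs lst in
      trans (sym (digit-∷ʳ xs j)) (proj₂ (adm L 1≤L) (trans (prefix ≤-refl) full))

  Admissible-∷ʳ⁺ : Admissible a xs → j ≤ a (suc L) → (last xs ≡ just (a L) → j ≡ 0) →
    Admissible a (xs ∷ʳ j)
  Admissible-∷ʳ⁺ adm j≤a top k 1≤k with <-cmp k L
  ... | tri< k<L _ _ =
    subst (_≤ a k) (sym (prefix (<⇒≤ k<L))) (proj₁ (adm k 1≤k)) ,
    λ full → trans (prefix k<L) (proj₂ (adm k 1≤k) (trans (sym (prefix (<⇒≤ k<L))) full))
  ... | tri≈ _ refl _ =
    subst (_≤ a L) (sym (prefix ≤-refl)) (proj₁ (adm L 1≤k)) ,
    λ full → trans (digit-∷ʳ xs j) (top (trans (last-digit xs 1≤k) (cong just (trans (sym (prefix ≤-refl)) full))))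
  ... | tri> _ _ L<k = bound , λ _ → digit-beyond (xs ∷ʳ j) (subst (_< suc k) (sym (length-∷ʳ xs j)) (s≤s L<k))
    where
    bound : digit (xs ∷ʳ j) k ≤ a k
    bound with k ≟ suc L
    ... | yes refl = subst (_≤ a (suc L)) (sym (digit-∷ʳ xs j)) j≤a
    ... | no  k≢1+L = subst (_≤ a k) (sym (digit-beyond (xs ∷ʳ j)
                        (subst (_< k) (sym (length-∷ʳ xs j)) (≤∧≢⇒< L<k (k≢1+L ∘ sym))))) z≤n

valueFrom-++ : ∀ a i xs ys → valueFrom a i (xs ++ ys) ≡ valueFrom a i xs ℤ.+ valueFrom a (i + length xs) ys
valueFrom-++ a i [] ys = begin
  valueFrom a i ys                ≡⟨ cong (λ m → valueFrom a m ys) (+-identityʳ i) ⟨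
  valueFrom a (i + 0) ys          ≡⟨ ℤ.+-identityˡ _ ⟨
  + 0 ℤ.+ valueFrom a (i + 0) ys  ∎
  where open ≡-Reasoning
valueFrom-++ a i (x ∷ xs) ys = begin
  term ℤ.+ valueFrom a (suc i) (xs ++ ys)
    ≡⟨ cong (ℤ._+_ term) (valueFrom-++ a (suc i) xs ys) ⟩
  term ℤ.+ (valueFrom a (suc i) xs ℤ.+ valueFrom a (suc i + length xs) ys)
    ≡⟨ ℤ.+-assoc term _ _ ⟨
  (term ℤ.+ valueFrom a (suc i) xs) ℤ.+ valueFrom a (suc i + length xs) ys
    ≡⟨ cong (λ m → (term ℤ.+ valueFrom a (suc i) xs) ℤ.+ valueFrom a m ys) (+-suc i (length xs)) ⟨
  (term ℤ.+ valueFrom a (suc i) xs) ℤ.+ valueFrom a (i + suc (length xs)) ys ∎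
  where
  open ≡-Reasoning
  term = + x ℤ.* qStar a i

dropLeadingZeros : List ℕ → List ℕ
dropLeadingZeros []            = []
dropLeadingZeros (zero ∷ rs)   = dropLeadingZeros rs
dropLeadingZeros (suc b ∷ rs)  = suc b ∷ rs

head-dropLeadingZeros : ∀ rs → head (dropLeadingZeros rs) ≢ just 0
head-dropLeadingZeros []           ()
head-dropLeadingZeros (zero ∷ rs)  = head-dropLeadingZeros rs
head-dropLeadingZeros (suc b ∷ rs) ()

dropLeadingZeros-id : ∀ rs → head rs ≢ just 0 → dropLeadingZeros rs ≡ rs
dropLeadingZeros-id []           _  = refl
dropLeadingZeros-id (zero ∷ rs)  nz = contradiction refl nz
dropLeadingZeros-id (suc b ∷ rs) _  = refl

dropLeadingZeros-replicate : ∀ k rs → dropLeadingZeros (replicate k 0 ++ rs) ≡ dropLeadingZeros rs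
dropLeadingZeros-replicate zero    rs = refl
dropLeadingZeros-replicate (suc k) rs = dropLeadingZeros-replicate k rs

length-padding : ∀ k (rs : List ℕ) → length (replicate k 0 ++ rs) ≡ k + length rs
length-padding k rs = trans (length-++ (replicate k 0)) (cong (_+ length rs) (length-replicate k))

signAlt-neg : ∀ n x → signAlt n (- x) ≡ - signAlt n x
signAlt-neg zero    x = refl
signAlt-neg (suc n) x = cong -_ (signAlt-neg n x)

signAlt-involutive : ∀ n x → signAlt n (signAlt n x) ≡ x
signAlt-involutive zero    x = refl
signAlt-involutive (suc n) x = begin
  - signAlt n (- signAlt n x)    ≡⟨ cong -_ (signAlt-neg n (signAlt n x)) ⟩
  - - signAlt n (signAlt n x)    ≡⟨ ℤ.neg-involutive _ ⟩
  signAlt n (signAlt n x)        ≡⟨ signAlt-involutive n x ⟩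
  x                              ∎
  where open ≡-Reasoning

signAlt-+ : ∀ n x y → signAlt n (x ℤ.+ y) ≡ signAlt n x ℤ.+ signAlt n y
signAlt-+ zero    x y = refl
signAlt-+ (suc n) x y = trans (cong -_ (signAlt-+ n x y)) (ℤ.neg-distrib-+ (signAlt n x) (signAlt n y))

signAlt-*ʳ : ∀ n x y → signAlt n (x ℤ.* y) ≡ x ℤ.* signAlt n y
signAlt-*ʳ zero    x y = refl
signAlt-*ʳ (suc n) x y = trans (cong -_ (signAlt-*ʳ n x y)) (ℤ.neg-distribʳ-* x (signAlt n y))

signAlt-even : ∀ m x → signAlt (m * 2) x ≡ x
signAlt-even zero    x = refl
signAlt-even (suc m) x = trans (ℤ.neg-involutive _) (signAlt-even m x)

oddity : ℕ → ℤ
oddity zero    = + 0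
oddity (suc n) = + 1 ℤ.- oddity n

oddity-even : ∀ m → oddity (m * 2) ≡ + 0
oddity-even zero    = refl
oddity-even (suc m) = cong (λ o → + 1 ℤ.- (+ 1 ℤ.- o)) (oddity-even m)

shift-to-ℕ : ∀ Z {P M} → ∣ Z ∣ < P → ∣ Z ∣ < M → Σ ℕ λ c → c < P + M × Z ℤ.+ + c ≡ + M
shift-to-ℕ (+ k) {P} {M} k<P k<M =
  M ∸ k , ≤-<-trans (m∸n≤m M k) (m<n+m M (≤-<-trans z≤n k<P)) ,
  trans (sym (ℤ.pos-+ k (M ∸ k))) (cong +_ (m+[n∸m]≡n (<⇒≤ k<M)))
shift-to-ℕ -[1+ k ] {P} {M} k<P _ =
  suc k + M , +-monoˡ-< M k<P , trans (cong (ℤ._+_ -[1+ k ]) (ℤ.pos-+ (suc k) M)) (cancel (+ suc k) (+ M))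
  where
  cancel : ∀ x y → - x ℤ.+ (x ℤ.+ y) ≡ y
  cancel = solve-∀

ℤ-+-cancelˡ : ∀ {x y} c → c ℤ.+ x ≡ c ℤ.+ y → x ≡ y
ℤ-+-cancelˡ {x} {y} c = ∙-cancelˡ ℤ.+-0-abelianGroup c x y

ℤ-+-cancelʳ : ∀ {x y} c → x ℤ.+ c ≡ y ℤ.+ c → x ≡ y
ℤ-+-cancelʳ {x} {y} c = ∙-cancelʳ ℤ.+-0-abelianGroup c x y

-- Inside this module digit strings rs = [b_n, …, b_1] are written most significant first.

module Expansion (a : ℕ → ℕ) (a-pos : ∀ k → 1 ≤ k → 1 ≤ a k) where

  qPrev : ℕ → ℕ
  qPrev zero    = 0
  qPrev (suc n) = q a n

  q-suc : ∀ n → q a (suc n) ≡ a (suc n) * q a n + qPrev n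
  q-suc zero    = refl
  q-suc (suc n) = refl

  a-suc-pos : ∀ n → 1 ≤ a (suc n)
  a-suc-pos n = a-pos (suc n) (s≤s z≤n)

  q+qPrev≤q-suc : ∀ n → q a n + qPrev n ≤ q a (suc n)
  q+qPrev≤q-suc n = subst (q a n + qPrev n ≤_) (sym (q-suc n))
    (+-monoˡ-≤ (qPrev n) (m≤n*m (q a n) (a (suc n)) {{>-nonZero (a-suc-pos n)}}))

  q-pos : ∀ n → 1 ≤ q a n
  q-pos zero    = s≤s z≤n
  q-pos (suc n) = ≤-trans (≤-trans (q-pos n) (m≤m+n (q a n) (qPrev n))) (q+qPrev≤q-suc n)

  n≤q : ∀ n → n ≤ q a n
  n≤q zero          = z≤n
  n≤q (suc zero)    = q-pos 1
  n≤q (suc (suc n)) = ≤-trans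
    (subst (_≤ q a (suc n) + q a n) (+-comm (suc n) 1) (+-mono-≤ (n≤q (suc n)) (q-pos n)))
    (q+qPrev≤q-suc (suc n))

  q-nonZero : ∀ n → NonZero (q a n)
  q-nonZero n = >-nonZero (q-pos n)

  Full : List ℕ → Set
  Full rs = head rs ≡ just (a (length rs))

  Admissibleʳ : List ℕ → Set
  Admissibleʳ []       = ⊤
  Admissibleʳ (j ∷ rs) = Admissibleʳ rs × j ≤ a (suc (length rs)) × (Full rs → j ≡ 0)

  valueʳ : List ℕ → ℤ
  valueʳ []       = + 0
  valueʳ (j ∷ rs) = valueʳ rs ℤ.+ + j ℤ.* qStar a (length rs)

  blockEnd : ℕ → ℕ → ℕ
  blockEnd n j = q a n + (j * q a n + qPrev n)

  rank : List ℕ → ℕ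
  rank []       = 0
  rank (j ∷ rs) = reflect (blockEnd (length rs) j) (rank rs)

  RankBounds : ℕ → List ℕ → Set
  RankBounds n rs = rank rs < q a n + qPrev n
                  × (Full rs → q a n ≤ rank rs)
                  × (¬ Full rs → rank rs < q a n)

  rank-InBlock : ∀ {n} j rs → length rs ≡ n → Admissibleʳ (j ∷ rs) → RankBounds n rs →
    InBlock (q a n) (qPrev n) j (rank (j ∷ rs))
  rank-InBlock j rs refl (_ , _ , top) (rank< , _ , notFull⇒) = Extendable⇒InBlock (rank< , extendable j top)
    where
    extendable : ∀ i → (Full rs → i ≡ 0) → i ≡ 0 ⊎ rank rs < q a (length rs)
    extendable zero    _   = inj₁ refl
    extendable (suc i) top = inj₂ (notFull⇒ (1+n≢0 ∘ top))

  rank-bounds : ∀ {n} rs → length rs ≡ n → Admissibleʳ rs → RankBounds n rs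
  rank-bounds [] refl _ = s≤s z≤n , (λ ()) , λ _ → s≤s z≤n
  rank-bounds (j ∷ rs) refl adm@(adm-rs , j≤A , _)
    with rank-InBlock j rs refl adm (rank-bounds rs refl adm-rs)
  ... | rank<end , start = rank<width , full⇒ , notFull⇒
    where
    n = length rs
    Q = q a n
    M = qPrev n
    A = a (suc n)
    rank<width : rank (j ∷ rs) < q a (suc n) + Q
    rank<width = <-≤-trans rank<end (begin
      Q + (j * Q + M)    ≤⟨ +-monoʳ-≤ Q (+-monoˡ-≤ M (*-monoˡ-≤ Q j≤A)) ⟩
      Q + (A * Q + M)    ≡⟨ +-comm Q (A * Q + M) ⟩
      (A * Q + M) + Q    ≡⟨ cong (_+ Q) (q-suc n) ⟨
      q a (suc n) + Q    ∎)
      where open ≤-Reasoning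
    full⇒ : Full (j ∷ rs) → q a (suc n) ≤ rank (j ∷ rs)
    full⇒ full = go start
      where
      j≡A = just-injective full
      go : j ≡ 0 ⊎ j * Q + M ≤ rank (j ∷ rs) → q a (suc n) ≤ rank (j ∷ rs)
      go (inj₁ j≡0)   = contradiction (subst (1 ≤_) (trans (sym j≡A) j≡0) (a-suc-pos n)) λ ()
      go (inj₂ start≤) = subst (_≤ rank (j ∷ rs)) (trans (cong (λ i → i * Q + M) j≡A) (sym (q-suc n))) start≤
    notFull⇒ : ¬ Full (j ∷ rs) → rank (j ∷ rs) < q a (suc n)
    notFull⇒ notFull = <-≤-trans rank<end (begin
      Q + (j * Q + M)    ≡⟨ +-assoc Q (j * Q) M ⟨
      suc j * Q + M      ≤⟨ +-monoˡ-≤ M (*-monoˡ-≤ Q (≤∧≢⇒< j≤A (notFull ∘ cong just))) ⟩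
      A * Q + M          ≡⟨ q-suc n ⟨
      q a (suc n)        ∎)
      where open ≤-Reasoning

  rank-< : ∀ {n} rs → length rs ≡ n → Admissibleʳ rs → rank rs < q a n + qPrev n
  rank-< rs len adm = proj₁ (rank-bounds rs len adm)

  rank<blockEnd : ∀ {n} j rs → length rs ≡ n → Admissibleʳ rs → rank rs < blockEnd n j
  rank<blockEnd {n} j rs len adm = <-≤-trans (rank-< rs len adm) (+-monoʳ-≤ (q a n) (m≤n+m (qPrev n) (j * q a n)))

  rank-injective : ∀ {n} rs ss → length rs ≡ n → length ss ≡ n → Admissibleʳ rs → Admissibleʳ ss →
    rank rs ≡ rank ss → rs ≡ ss
  rank-injective [] [] _ _ _ _ _ = refl
  rank-injective [] (_ ∷ _) refl () _ _ _
  rank-injective (_ ∷ _) [] refl () _ _ _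
  rank-injective (j ∷ rs) (k ∷ ss) refl len-kss adm-jrs@(adm-rs , _) adm-kss@(adm-ss , _) rank≡ =
    cong₂ _∷_ j≡k (rank-injective rs ss refl len-ss adm-rs adm-ss (reflect-injective rs<end ss<end reflect≡))
    where
    n = length rs
    len-ss = suc-injective len-kss
    j≡k : j ≡ k
    j≡k = InBlock-unique (rank-InBlock j rs refl adm-jrs (rank-bounds rs refl adm-rs))
      (subst (InBlock (q a n) (qPrev n) k) (sym rank≡) (rank-InBlock k ss len-ss adm-kss (rank-bounds ss len-ss adm-ss)))
    rs<end = rank<blockEnd j rs refl adm-rs
    ss<end = rank<blockEnd j ss len-ss adm-ss
    reflect≡ : reflect (blockEnd n j) (rank rs) ≡ reflect (blockEnd n j) (rank ss)
    reflect≡ = trans rank≡ (cong₂ (λ m i → reflect (blockEnd m i) (rank ss)) len-ss (sym j≡k))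

  rank-surjective : ∀ n {c} → c < q a n + qPrev n →
    Σ (List ℕ) λ rs → length rs ≡ n × Admissibleʳ rs × rank rs ≡ c
  rank-surjective zero {zero} _ = [] , refl , tt , refl
  rank-surjective zero {suc c} (s≤s ())
  rank-surjective (suc n) {c} c<width
    with InBlock-exists {q a n} {qPrev n} (a (suc n))
           (subst (c <_) (trans (cong (_+ q a n) (q-suc n)) (+-comm _ (q a n))) c<width)
  ... | j , j≤A , j-block@(c<end , _)
    with InBlock⇒Extendable {{q-nonZero n}} j-block
  ... | rank< , ext
    with rank-surjective n rank<
  ... | rs , refl , adm , rank≡ =
    j ∷ rs , refl , (adm , j≤A , top ext) , trans (cong (reflect (blockEnd n j)) rank≡) (reflect-involutive c<end)
    where
    top : j ≡ 0 ⊎ reflect (blockEnd n j) c < q a n → Full rs → j ≡ 0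
    top (inj₁ j≡0) _    = j≡0
    top (inj₂ <Q)  full =
      contradiction (proj₁ (proj₂ (rank-bounds rs refl adm)) full) (<⇒≱ (subst (_< q a n) (sym rank≡) <Q))

  value-rank : ∀ {n} rs → length rs ≡ n → Admissibleʳ rs →
    signAlt n (valueʳ rs) ℤ.+ + rank rs ℤ.+ oddity n ≡ + qPrev n
  value-rank [] refl _ = refl
  value-rank (j ∷ rs) refl (adm-rs , _) = begin
    signAlt (suc n) (V ℤ.+ + j ℤ.* qStar a n) ℤ.+ + rank (j ∷ rs) ℤ.+ oddity (suc n)
      ≡⟨ cong₂ (λ s r → s ℤ.+ r ℤ.+ oddity (suc n)) signed ranked ⟩
    - (S ℤ.+ + j ℤ.* + Q) ℤ.+ ((+ Q ℤ.+ (+ j ℤ.* + Q ℤ.+ + M)) ℤ.- (+ 1 ℤ.+ + rank rs))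
      ℤ.+ (+ 1 ℤ.- oddity n)
      ≡⟨ rearrange S (+ rank rs) (oddity n) (+ j) (+ Q) (+ M) ⟩
    + Q ℤ.+ (+ M ℤ.- (S ℤ.+ + rank rs ℤ.+ oddity n))
      ≡⟨ cong (λ x → + Q ℤ.+ (+ M ℤ.- x)) (value-rank rs refl adm-rs) ⟩
    + Q ℤ.+ (+ M ℤ.- + M)
      ≡⟨ cong (ℤ._+_ (+ Q)) (ℤ.+-inverseʳ (+ M)) ⟩
    + Q ℤ.+ + 0
      ≡⟨ ℤ.+-identityʳ (+ Q) ⟩
    + Q ∎
    where
    open ≡-Reasoning
    n = length rs
    Q = q a n
    M = qPrev n
    V = valueʳ rs
    S = signAlt n V
    signed : signAlt (suc n) (V ℤ.+ + j ℤ.* qStar a n) ≡ - (S ℤ.+ + j ℤ.* + Q)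
    signed = cong -_ (trans (signAlt-+ n V _) (cong (ℤ._+_ S)
      (trans (signAlt-*ʳ n (+ j) (qStar a n)) (cong (ℤ._*_ (+ j)) (signAlt-involutive n (+ Q))))))
    ranked : + rank (j ∷ rs) ≡ (+ Q ℤ.+ (+ j ℤ.* + Q ℤ.+ + M)) ℤ.- (+ 1 ℤ.+ + rank rs)
    ranked = begin
      + (blockEnd n j ∸ suc (rank rs))          ≡⟨ ℤ.⊖-≥ (rank<blockEnd j rs refl adm-rs) ⟨
      blockEnd n j ℤ.⊖ suc (rank rs)            ≡⟨ ℤ.m-n≡m⊖n (blockEnd n j) (suc (rank rs)) ⟨
      + blockEnd n j ℤ.- + suc (rank rs)        ≡⟨ cong₂ ℤ._-_ end (ℤ.pos-+ 1 (rank rs)) ⟩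
      (+ Q ℤ.+ (+ j ℤ.* + Q ℤ.+ + M)) ℤ.- (+ 1 ℤ.+ + rank rs) ∎
      where
      end : + blockEnd n j ≡ + Q ℤ.+ (+ j ℤ.* + Q ℤ.+ + M)
      end = trans (ℤ.pos-+ Q _) (cong (ℤ._+_ (+ Q)) (trans (ℤ.pos-+ (j * Q) M) (cong (ℤ._+ + M) (ℤ.pos-* j Q))))
    rearrange : ∀ S c o j Q M →
      - (S ℤ.+ j ℤ.* Q) ℤ.+ ((Q ℤ.+ (j ℤ.* Q ℤ.+ M)) ℤ.- (+ 1 ℤ.+ c)) ℤ.+ (+ 1 ℤ.- o)
        ≡ Q ℤ.+ (M ℤ.- (S ℤ.+ c ℤ.+ o))
    rearrange = solve-∀

  valueʳ-injective : ∀ {n} rs ss → length rs ≡ n → length ss ≡ n → Admissibleʳ rs → Admissibleʳ ss →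
    valueʳ rs ≡ valueʳ ss → rs ≡ ss
  valueʳ-injective {n} rs ss len-rs len-ss adm-rs adm-ss value≡ =
    rank-injective rs ss len-rs len-ss adm-rs adm-ss
      (ℤ.+-injective (ℤ-+-cancelˡ (signAlt n (valueʳ rs)) (ℤ-+-cancelʳ (oddity n) (begin
        signAlt n (valueʳ rs) ℤ.+ + rank rs ℤ.+ oddity n  ≡⟨ value-rank rs len-rs adm-rs ⟩
        + qPrev n                                         ≡⟨ value-rank ss len-ss adm-ss ⟨
        signAlt n (valueʳ ss) ℤ.+ + rank ss ℤ.+ oddity n  ≡⟨ cong (λ v → signAlt n v ℤ.+ + rank ss ℤ.+ oddity n) value≡ ⟨
        signAlt n (valueʳ rs) ℤ.+ + rank ss ℤ.+ oddity n  ∎))))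
    where open ≡-Reasoning

  value-rank-even : ∀ m rs → length rs ≡ m * 2 → Admissibleʳ rs → valueʳ rs ℤ.+ + rank rs ≡ + qPrev (m * 2)
  value-rank-even m rs len adm = begin
    valueʳ rs ℤ.+ + rank rs                                    ≡⟨ ℤ.+-identityʳ _ ⟨
    valueʳ rs ℤ.+ + rank rs ℤ.+ + 0                            ≡⟨ cong₂ (λ v o → v ℤ.+ + rank rs ℤ.+ o) (signAlt-even m _) (oddity-even m) ⟨
    signAlt (m * 2) (valueʳ rs) ℤ.+ + rank rs ℤ.+ oddity (m * 2) ≡⟨ value-rank rs len adm ⟩
    + qPrev (m * 2)                                            ∎
    where open ≡-Reasoning

  valueʳ-surjective : ∀ Z → Σ (List ℕ) λ rs → Admissibleʳ rs × valueʳ rs ≡ Z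
  valueʳ-surjective Z =
    let c , c<width , Z+c≡M = shift-to-ℕ Z {q a n} {qPrev n} ∣Z∣<q ∣Z∣<qPrev
        rs , len , adm , rank≡ = rank-surjective n c<width
        value+c≡M = subst (λ r → valueʳ rs ℤ.+ + r ≡ + qPrev n) rank≡ (value-rank-even m rs len adm)
    in rs , adm , ℤ-+-cancelʳ (+ c) (trans value+c≡M (sym Z+c≡M))
    where
    m = suc ∣ Z ∣
    n = m * 2
    ∣Z∣<q : ∣ Z ∣ < q a n
    ∣Z∣<q = <-≤-trans (s≤s (≤-trans (m≤m*n ∣ Z ∣ 2) (n≤1+n _))) (n≤q n)
    ∣Z∣<qPrev : ∣ Z ∣ < qPrev n
    ∣Z∣<qPrev = <-≤-trans (s≤s (m≤m*n ∣ Z ∣ 2)) (n≤q (suc (∣ Z ∣ * 2)))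

  valueʳ-0∷ : ∀ rs → valueʳ (0 ∷ rs) ≡ valueʳ rs
  valueʳ-0∷ rs = ℤ.+-identityʳ (valueʳ rs)

  Admissibleʳ-padding : ∀ k rs → Admissibleʳ rs → Admissibleʳ (replicate k 0 ++ rs)
  Admissibleʳ-padding zero    rs adm = adm
  Admissibleʳ-padding (suc k) rs adm = Admissibleʳ-padding k rs adm , z≤n , λ _ → refl

  valueʳ-padding : ∀ k rs → valueʳ (replicate k 0 ++ rs) ≡ valueʳ rs
  valueʳ-padding zero    rs = refl
  valueʳ-padding (suc k) rs = trans (valueʳ-0∷ (replicate k 0 ++ rs)) (valueʳ-padding k rs)

  Admissibleʳ-dropLeadingZeros : ∀ rs → Admissibleʳ rs → Admissibleʳ (dropLeadingZeros rs)
  Admissibleʳ-dropLeadingZeros []           _          = tt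
  Admissibleʳ-dropLeadingZeros (zero ∷ rs)  (adm , _)  = Admissibleʳ-dropLeadingZeros rs adm
  Admissibleʳ-dropLeadingZeros (suc b ∷ rs) adm        = adm

  valueʳ-dropLeadingZeros : ∀ rs → valueʳ (dropLeadingZeros rs) ≡ valueʳ rs
  valueʳ-dropLeadingZeros []           = refl
  valueʳ-dropLeadingZeros (zero ∷ rs)  = trans (valueʳ-dropLeadingZeros rs) (sym (valueʳ-0∷ rs))
  valueʳ-dropLeadingZeros (suc b ∷ rs) = refl

  valueʳ-injective-normal : ∀ rs ss → Admissibleʳ rs → Admissibleʳ ss → head rs ≢ just 0 → head ss ≢ just 0 →
    valueʳ rs ≡ valueʳ ss → rs ≡ ss
  valueʳ-injective-normal rs ss adm-rs adm-ss nz-rs nz-ss value≡ = begin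
    rs                                                ≡⟨ dropLeadingZeros-id rs nz-rs ⟨
    dropLeadingZeros rs                               ≡⟨ dropLeadingZeros-replicate (length ss) rs ⟨
    dropLeadingZeros (replicate (length ss) 0 ++ rs)  ≡⟨ cong dropLeadingZeros padded≡ ⟩
    dropLeadingZeros (replicate (length rs) 0 ++ ss)  ≡⟨ dropLeadingZeros-replicate (length rs) ss ⟩
    dropLeadingZeros ss                               ≡⟨ dropLeadingZeros-id ss nz-ss ⟩
    ss                                                ∎
    where
    open ≡-Reasoning
    padded≡ : replicate (length ss) 0 ++ rs ≡ replicate (length rs) 0 ++ ss
    padded≡ = valueʳ-injective _ _
      (length-padding (length ss) rs) (trans (length-padding (length rs) ss) (+-comm (length rs) (length ss)))
      (Admissibleʳ-padding (length ss) rs adm-rs) (Admissibleʳ-padding (length rs) ss adm-ss)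
      (trans (valueʳ-padding (length ss) rs) (trans value≡ (sym (valueʳ-padding (length rs) ss))))

  value-reverse : ∀ rs → value a (reverse rs) ≡ valueʳ rs
  value-reverse []       = refl
  value-reverse (j ∷ rs) = begin
    value a (reverse (j ∷ rs))                                                 ≡⟨ cong (value a) (unfold-reverse j rs) ⟩
    value a (reverse rs ∷ʳ j)                                                  ≡⟨ valueFrom-++ a 0 (reverse rs) [ j ] ⟩
    value a (reverse rs) ℤ.+ (+ j ℤ.* qStar a (length (reverse rs)) ℤ.+ + 0)   ≡⟨ cong₂ ℤ._+_ (value-reverse rs) top ⟩
    valueʳ rs ℤ.+ + j ℤ.* qStar a (length rs)                                  ∎
    where
    open ≡-Reasoning
    top = trans (ℤ.+-identityʳ _) (cong (λ m → + j ℤ.* qStar a m) (length-reverse rs))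

  Full⇒last : ∀ rs → Full rs → last (reverse rs) ≡ just (a (length (reverse rs)))
  Full⇒last rs full = trans (last-reverse rs) (trans full (cong (just ∘ a) (sym (length-reverse rs))))

  last⇒Full : ∀ rs → last (reverse rs) ≡ just (a (length (reverse rs))) → Full rs
  last⇒Full rs lst = trans (sym (last-reverse rs)) (trans lst (cong (just ∘ a) (length-reverse rs)))

  Admissibleʳ⇒Admissible : ∀ rs → Admissibleʳ rs → Admissible a (reverse rs)
  Admissibleʳ⇒Admissible []       _                   k _ = z≤n , λ _ → refl
  Admissibleʳ⇒Admissible (j ∷ rs) (adm-rs , j≤a , top) =
    subst (Admissible a) (sym (unfold-reverse j rs))
      (Admissible-∷ʳ⁺ a (reverse rs) j (Admissibleʳ⇒Admissible rs adm-rs)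
        (subst (λ m → j ≤ a (suc m)) (sym (length-reverse rs)) j≤a) (top ∘ last⇒Full rs))

  Admissible⇒Admissibleʳ : ∀ rs → Admissible a (reverse rs) → Admissibleʳ rs
  Admissible⇒Admissibleʳ []       _ = tt
  Admissible⇒Admissibleʳ (j ∷ rs) adm
    with Admissible-∷ʳ⁻ a (reverse rs) j (subst (Admissible a) (unfold-reverse j rs) adm)
  ... | adm-rs , j≤a , top =
    Admissible⇒Admissibleʳ rs adm-rs , subst (λ m → j ≤ a (suc m)) (length-reverse rs) j≤a , top ∘ Full⇒last rs

  expansion-exists : ∀ Z → Σ (List ℕ) λ bs → Admissible a bs × NoTrailingZero bs × value a bs ≡ Z
  expansion-exists Z =
    let rs , adm , value≡ = valueʳ-surjective Z
        ns = dropLeadingZeros rs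
    in reverse ns ,
       Admissibleʳ⇒Admissible ns (Admissibleʳ-dropLeadingZeros rs adm) ,
       head-dropLeadingZeros rs ∘ trans (sym (last-reverse ns)) ,
       trans (value-reverse ns) (trans (valueʳ-dropLeadingZeros rs) value≡)

  expansion-unique : ∀ bs cs → Admissible a bs → Admissible a cs → NoTrailingZero bs → NoTrailingZero cs →
    value a bs ≡ value a cs → bs ≡ cs
  expansion-unique bs cs adm-bs adm-cs ntz-bs ntz-cs value≡ =
    reverse-injective (valueʳ-injective-normal (reverse bs) (reverse cs)
      (reversed-Admissibleʳ bs adm-bs) (reversed-Admissibleʳ cs adm-cs)
      (reversed-head bs ntz-bs) (reversed-head cs ntz-cs)
      (trans (reversed-valueʳ bs) (trans value≡ (sym (reversed-valueʳ cs)))))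
    where
    reversed-Admissibleʳ : ∀ xs → Admissible a xs → Admissibleʳ (reverse xs)
    reversed-Admissibleʳ xs adm =
      Admissible⇒Admissibleʳ (reverse xs) (subst (Admissible a) (sym (reverse-involutive xs)) adm)
    reversed-head : ∀ xs → NoTrailingZero xs → head (reverse xs) ≢ just 0
    reversed-head xs ntz = ntz ∘ trans (cong last (sym (reverse-involutive xs))) ∘ trans (last-reverse (reverse xs))
    reversed-valueʳ : ∀ xs → valueʳ (reverse xs) ≡ value a xs
    reversed-valueʳ xs = trans (sym (value-reverse (reverse xs))) (cong (value a) (reverse-involutive xs))

theorem2 : (a : ℕ → ℕ) → (∀ k → 1 ≤ k → 1 ≤ a k) → (Z : ℤ) →
    Σ (List ℕ) (λ bs →
      (Admissible a bs × NoTrailingZero bs × value a bs ≡ Z) ×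
      (∀ cs → Admissible a cs → NoTrailingZero cs → value a cs ≡ Z → cs ≡ bs))
theorem2 a a-pos Z =
  let bs , adm , ntz , value≡ = expansion-exists Z
  in bs , (adm , ntz , value≡) ,
     λ cs adm-cs ntz-cs value-cs → expansion-unique cs bs adm-cs adm ntz-cs ntz (trans value-cs (sym value≡))
  where open Expansion a a-pos
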